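{- Let $M_1\le M_2$ be $n\times n$ matrices over $\mathbb{F}_2$ of ranks $m_1\le m_2$. Then the map $\psi(A)=A-M_1$ is an isomorphism of posets from $\mathcal{M}_{M_1}^{M_2}$ onto $\mathcal{M}^{M_2-M_1}$ (a bijection such that both it and its inverse preserve $\le$), and for every $A\in\mathcal{M}_{M_1}^{M_2}$, $\mathrm{rank}(\psi(A))=\mathrm{rank}(A)-m_1$.
   Context: $\mathcal{M}$ is the set of $n\times n$ matrices over $\mathbb{F}_2$ with the domination order: $B\le A$ iff $\mathrm{rank}(A)=\mathrm{rank}(B)+\mathrm{rank}(A-B)$ (this is a partial order). For $M_1\le M_2$, the interval $\mathcal{M}_{M_1}^{M_2}=\{A\in\mathcal{M}: M_1\le A\le M_2\}$ with the induced order, and $\mathcal{M}^{M}=\mathcal{M}_0^{M}=\{A: A\le M\}$. -}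

module Defs where

open import Data.Bool using (Bool; true; false; _xor_; _∧_)
open import Data.Nat using (ℕ; zero; suc; _+_)
open import Data.Fin using (Fin; zero; suc)
open import Data.Product using (Σ; _×_)
open import Relation.Binary.PropositionalEquality using (_≡_)
open import Relation.Nullary using (¬_)

-- The field F₂ is modelled by Bool: addition = xor, multiplication = ∧.
F₂ : Set
F₂ = Bool

Mat : ℕ → Set
Mat n = Fin n → Fin n → F₂

_⊕_ : ∀ {n} → Mat n → Mat n → Mat n
(A ⊕ B) i j = A i j xor B i j

_⊖_ : ∀ {n} → Mat n → Mat n → Mat n
(A ⊖ B) i j = A i j xor B i j   -- a - b = a + b in F₂

𝟎 : ∀ {n} → Mat n
𝟎 i j = false

_≈_ : ∀ {n} → Mat n → Mat n → Set
A ≈ B = ∀ i j → A i j ≡ B i j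

sumF : ∀ k → (Fin k → F₂) → F₂
sumF zero    c = false
sumF (suc k) c = c zero xor sumF k (λ i → c (suc i))

LinIndep : ∀ {n k} → (Fin k → Fin n → F₂) → Set
LinIndep {n} {k} v =
  (c : Fin k → F₂) → (∀ j → sumF k (λ i → c i ∧ v i j) ≡ false) → ∀ i → c i ≡ false

cols : ∀ {n k} → Mat n → (Fin k → Fin n) → Fin k → Fin n → F₂
cols A f i j = A j (f i)

HasRank : ∀ {n} → Mat n → ℕ → Set
HasRank {n} A r =
  Σ (Fin r → Fin n) (λ f → LinIndep (cols A f)) ×
  ((f : Fin (suc r) → Fin n) → ¬ LinIndep (cols A f))

-- Domination order: B ≤ A iff rank(A) = rank(B) + rank(A - B).
_≼_ : ∀ {n} → Mat n → Mat n → Set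
B ≼ A = ∀ a b d → HasRank A a → HasRank B b → HasRank (A ⊖ B) d → a ≡ b + d

InInterval : ∀ {n} → Mat n → Mat n → Mat n → Set
InInterval M₁ M₂ A = (M₁ ≼ A) × (A ≼ M₂)

ψ : ∀ {n} → Mat n → Mat n → Mat n
ψ M₁ A = A ⊖ M₁

φ : ∀ {n} → Mat n → Mat n → Mat n
φ M₁ B = B ⊕ M₁

-- Given M₁ ≤ A and M₁ ≤ A′, the equations rank A = rank M₁ + rank (A - M₁) and
-- rank A′ = rank M₁ + rank (A′ - M₁) turn rank A′ = rank A + rank (A′ - A) into
-- rank (A′ - M₁) = rank (A - M₁) + rank (A′ - A), since (A′ - M₁) - (A - M₁) = A′ - A: so ψ and
-- its inverse preserve the order, and rank ψ(A) = rank A - m₁.  That ψ⁻¹(B) = B + M₁ lies above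
-- M₁ follows from subadditivity of rank, which in turn rests on the Steinitz exchange lemma.
-- Ranks exist because a greedy choice of columns gives a spanning independent family.
module Submission where

open import Defs
open import Algebra.Bundles using (CommutativeRing)
open import Data.Bool using (Bool; true; false; _xor_; _∧_; _≟_)
open import Data.Bool.Properties
  using (xor-∧-commutativeRing; xor-assoc; xor-comm; xor-same; xor-identityʳ;
         ∧-assoc; ∧-identityʳ; ∧-distribˡ-xor; ∧-distribʳ-xor; ¬-not)
open import Data.Fin using (Fin; zero; suc; punchIn; _↑ˡ_; _↑ʳ_)
open import Data.Fin.Properties using (any?; all?)
open import Data.Fin.Subset.Properties using (anySubset?)
open import Data.Nat using (ℕ; zero; suc; _+_; _≤_; _<_; _∸_; s≤s; _≤?_)
open import Data.Nat.Properties
  using (≤-antisym; ≰⇒>; n≮n; m<n⇒m<1+n; +-assoc; +-cancelˡ-≡; +-cancelʳ-≤; m+n∸m≡n)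
open import Data.Product using (Σ; ∃; _×_; _,_; proj₁; proj₂)
open import Data.Vec using (lookup; tabulate)
open import Data.Vec.Properties using (lookup∘tabulate)
open import Data.Vec.Functional using (Vector; _∷_; _++_; tail; insertAt; removeAt)
open import Data.Vec.Functional.Properties using (lookup-++ˡ; lookup-++ʳ; insertAt-lookup; insertAt-punchIn)
open import Function using (_∘_; _⇔_; mk⇔; Equivalence)
import Function.Properties.Equivalence as ⇔
open import Relation.Binary.PropositionalEquality
open import Relation.Nullary using (¬_; Dec; yes; no; contradiction)
open import Relation.Nullary.Decidable using (map′)

open import Algebra.Properties.Semiring.Sum (CommutativeRing.semiring xor-∧-commutativeRing)
  using (sum; sum-cong-≗; sum-remove; ∑-distrib-+; *-distribˡ-sum; *-distribʳ-sum; sum-replicate-zero)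

private
  variable
    k m n : ℕ

xor-cancelʳ : ∀ x y → (x xor y) xor y ≡ x
xor-cancelʳ x y = trans (xor-assoc x y y) (trans (cong (x xor_) (xor-same y)) (xor-identityʳ x))

xor≡false⇒≡ : ∀ {x y} → x xor y ≡ false → x ≡ y
xor≡false⇒≡ {x} {y} eq = trans (sym (xor-cancelʳ x y)) (cong (_xor y) eq)

xor-recombine : ∀ x y → x xor (y xor x) ≡ y
xor-recombine x y = trans (xor-comm x (y xor x)) (xor-cancelʳ y x)

xor-cancel-common : ∀ x y z → (x xor z) xor (y xor z) ≡ x xor y
xor-cancel-common x y z = begin
  (x xor z) xor (y xor z)  ≡⟨ cong ((x xor z) xor_) (xor-comm y z) ⟩
  (x xor z) xor (z xor y)  ≡⟨ xor-assoc x z (z xor y) ⟩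
  x xor (z xor (z xor y))  ≡⟨ cong (x xor_) (sym (xor-assoc z z y)) ⟩
  x xor ((z xor z) xor y)  ≡⟨ cong (λ b → x xor (b xor y)) (xor-same z) ⟩
  x xor y                  ∎
  where open ≡-Reasoning

xor-rotate : ∀ x y z → x xor (y xor z) ≡ (x xor z) xor y
xor-rotate x y z = trans (cong (x xor_) (xor-comm y z)) (sym (xor-assoc x z y))

sumF≡sum : ∀ k (c : Fin k → F₂) → sumF k c ≡ sum c
sumF≡sum zero    c = refl
sumF≡sum (suc k) c = cong (c zero xor_) (sumF≡sum k (tail c))

sum-++ : ∀ m {n} (f : Fin (m + n) → F₂) → sum f ≡ sum (f ∘ (_↑ˡ n)) xor sum (f ∘ (m ↑ʳ_))
sum-++ zero    f = refl
sum-++ (suc m) f = trans (cong (f zero xor_) (sum-++ m (tail f))) (sym (xor-assoc (f zero) _ _))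

lincomb : (Fin k → F₂) → (Fin k → Vector F₂ n) → Vector F₂ n
lincomb c v j = sum (λ i → c i ∧ v i j)

_∈Span_ : Vector F₂ n → (Fin k → Vector F₂ n) → Set
x ∈Span v = ∃ λ c → ∀ j → lincomb c v j ≡ x j

Dependent : (Fin k → Vector F₂ n) → Set
Dependent {k} v = Σ (Fin k → F₂) λ c → (∀ j → lincomb c v j ≡ false) × ∃ λ i → c i ≡ true

lincomb-xor : ∀ (c d : Fin k → F₂) (v : Fin k → Vector F₂ n) j →
              lincomb (λ i → c i xor d i) v j ≡ lincomb c v j xor lincomb d v j
lincomb-xor c d v j =
  trans (sum-cong-≗ (λ i → ∧-distribʳ-xor (v i j) (c i) (d i)))
        (∑-distrib-+ (λ i → c i ∧ v i j) (λ i → d i ∧ v i j))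

lincomb-scale : ∀ b (c : Fin k → F₂) (v : Fin k → Vector F₂ n) j →
                lincomb (λ i → b ∧ c i) v j ≡ b ∧ lincomb c v j
lincomb-scale b c v j = begin
  sum (λ i → (b ∧ c i) ∧ v i j)  ≡⟨ sum-cong-≗ (λ i → ∧-assoc b (c i) (v i j)) ⟩
  sum (λ i → b ∧ (c i ∧ v i j))  ≡⟨ sym (*-distribˡ-sum b (λ i → c i ∧ v i j)) ⟩
  b ∧ lincomb c v j              ∎
  where open ≡-Reasoning

lincomb-tail : ∀ (c : Fin (suc k) → F₂) (v : Fin (suc k) → Vector F₂ n) → c zero ≡ false →
               ∀ j → lincomb c v j ≡ lincomb (tail c) (tail v) j
lincomb-tail c v c₀≡false j = cong (λ b → (b ∧ v zero j) xor lincomb (tail c) (tail v) j) c₀≡false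

lincomb-++ : ∀ (a : Fin m → F₂) (b : Fin k → F₂) (u : Fin m → Vector F₂ n) (w : Fin k → Vector F₂ n) j →
             lincomb (a ++ b) (u ++ w) j ≡ lincomb a u j xor lincomb b w j
lincomb-++ {m} {k} a b u w j = trans (sum-++ m _)
  (cong₂ _xor_ (sum-cong-≗ (λ i → cong₂ (λ x y → x ∧ y j) (lookup-++ˡ a b i) (lookup-++ˡ u w i)))
               (sum-cong-≗ (λ i → cong₂ (λ x y → x ∧ y j) (lookup-++ʳ a b i) (lookup-++ʳ u w i))))

∈Span-++ : ∀ {x y : Vector F₂ n} {u : Fin m → Vector F₂ n} {w : Fin k → Vector F₂ n} →
           x ∈Span u → y ∈Span w → (λ j → x j xor y j) ∈Span (u ++ w)
∈Span-++ {u = u} {w} (a , ua≡x) (b , wb≡y) =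
  a ++ b , λ j → trans (lincomb-++ a b u w j) (cong₂ _xor_ (ua≡x j) (wb≡y j))

_∈Span?_ : (x : Vector F₂ n) (v : Fin k → Vector F₂ n) → Dec (x ∈Span v)
x ∈Span? v = map′ (λ (s , eq) → lookup s , eq) fromCoefficients
  (anySubset? λ s → all? λ j → lincomb (lookup s) v j ≟ x j)
  where
  fromCoefficients : x ∈Span v → ∃ λ s → ∀ j → lincomb (lookup s) v j ≡ x j
  fromCoefficients (c , eq) =
    tabulate c , λ j → trans (sum-cong-≗ λ i → cong (_∧ v i j) (lookup∘tabulate c i)) (eq j)

dependent⇒¬LinIndep : ∀ {v : Fin k → Vector F₂ n} → Dependent v → ¬ LinIndep v
dependent⇒¬LinIndep {k} (c , rel , i , cᵢ) independent =
  contradiction (trans (sym cᵢ) (independent c (λ j → trans (sumF≡sum k _) (rel j)) i)) λ ()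

LinIndep-cong : ∀ {u v : Fin k → Vector F₂ n} → (∀ i j → u i j ≡ v i j) → LinIndep u → LinIndep v
LinIndep-cong {k} u≡v independent c rel = independent c λ j →
  trans (sumF≡sum k _)
        (trans (sum-cong-≗ λ i → cong (c i ∧_) (u≡v i j)) (trans (sym (sumF≡sum k _)) (rel j)))

LinIndep-∷ : ∀ {x : Vector F₂ n} {v : Fin k → Vector F₂ n} →
             LinIndep v → ¬ x ∈Span v → LinIndep (x ∷ v)
LinIndep-∷ {k = k} {x} {v} independent x∉v c rel = λ where
    zero    → c₀≡false
    (suc i) → independent (tail c)
                (λ j → subst (λ b → (b ∧ x j) xor sumF k (λ t → c (suc t) ∧ v t j) ≡ false) c₀≡false (rel j)) i
  where
  open ≡-Reasoning
  c₀≡false : c zero ≡ false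
  c₀≡false with c zero
  ... | false = refl
  ... | true  = contradiction
    (tail c , λ j → sym (xor≡false⇒≡ (begin
       x j xor lincomb (tail c) v j             ≡⟨ cong (x j xor_) (sym (sumF≡sum k _)) ⟩
       x j xor sumF k (λ t → c (suc t) ∧ v t j) ≡⟨ rel j ⟩
       false                                    ∎)))
    x∉v

shear : (w : Fin (suc k) → Vector F₂ n) → Fin (suc k) → (Fin k → F₂) → Fin k → Vector F₂ n
shear w i β t j = w (punchIn i t) j xor (β t ∧ w i j)

lincomb-shear : ∀ (w : Fin (suc k) → Vector F₂ n) i β (c : Fin k → F₂) j →
                lincomb c (shear w i β) j ≡ lincomb c (removeAt w i) j xor (sum (λ t → c t ∧ β t) ∧ w i j)
lincomb-shear w i β c j = begin
  sum (λ t → c t ∧ (w (punchIn i t) j xor (β t ∧ w i j)))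
    ≡⟨ sum-cong-≗ (λ t → ∧-distribˡ-xor (c t) _ _) ⟩
  sum (λ t → (c t ∧ w (punchIn i t) j) xor (c t ∧ (β t ∧ w i j)))
    ≡⟨ ∑-distrib-+ (λ t → c t ∧ w (punchIn i t) j) (λ t → c t ∧ (β t ∧ w i j)) ⟩
  lincomb c (removeAt w i) j xor sum (λ t → c t ∧ (β t ∧ w i j))
    ≡⟨ cong (lincomb c (removeAt w i) j xor_) (sum-cong-≗ (λ t → sym (∧-assoc (c t) (β t) (w i j)))) ⟩
  lincomb c (removeAt w i) j xor sum (λ t → (c t ∧ β t) ∧ w i j)
    ≡⟨ cong (lincomb c (removeAt w i) j xor_) (sym (*-distribʳ-sum (w i j) (λ t → c t ∧ β t))) ⟩
  lincomb c (removeAt w i) j xor (sum (λ t → c t ∧ β t) ∧ w i j) ∎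
  where open ≡-Reasoning

dependent-unshear : ∀ (w : Fin (suc k) → Vector F₂ n) i β → Dependent (shear w i β) → Dependent w
dependent-unshear w i β (c , rel , t , cₜ) =
  insertAt c i γ , rel′ , punchIn i t , trans (insertAt-punchIn c i γ t) cₜ
  where
  γ : F₂
  γ = sum (λ t → c t ∧ β t)
  rel′ : ∀ j → lincomb (insertAt c i γ) w j ≡ false
  rel′ j = begin
    lincomb (insertAt c i γ) w j
      ≡⟨ sum-remove {i = i} (λ t → insertAt c i γ t ∧ w t j) ⟩
    (insertAt c i γ i ∧ w i j) xor lincomb (removeAt (insertAt c i γ) i) (removeAt w i) j
      ≡⟨ cong₂ (λ b r → (b ∧ w i j) xor r) (insertAt-lookup c i γ)
               (sum-cong-≗ λ t → cong (_∧ w (punchIn i t) j) (insertAt-punchIn c i γ t)) ⟩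
    (γ ∧ w i j) xor lincomb c (removeAt w i) j
      ≡⟨ xor-comm (γ ∧ w i j) (lincomb c (removeAt w i) j) ⟩
    lincomb c (removeAt w i) j xor (γ ∧ w i j)
      ≡⟨ sym (lincomb-shear w i β c j) ⟩
    lincomb c (shear w i β) j
      ≡⟨ rel j ⟩
    false ∎
    where open ≡-Reasoning

-- Steinitz exchange: if some w i uses s₀, shearing w i out of the other vectors puts them in the
-- span of tail s.
steinitz : ∀ m {k} (s : Fin m → Vector F₂ n) (w : Fin k → Vector F₂ n) (a : Fin k → Fin m → F₂) →
           (∀ i j → lincomb (a i) s j ≡ w i j) → m < k → Dependent w
steinitz zero {suc k} s w a sa≡w _ =
  (λ _ → true) , (λ j → trans (sum-cong-≗ λ i → sym (sa≡w i j)) (sum-replicate-zero (suc k))) , zero , refl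
steinitz (suc m) {suc k} s w a sa≡w (s≤s m<k) with any? (λ i → a i zero ≟ true)
... | no noneUseHead =
  steinitz m (tail s) w (tail ∘ a)
    (λ i j → trans (sym (lincomb-tail (a i) s (¬-not λ aᵢ₀ → noneUseHead (i , aᵢ₀)) j)) (sa≡w i j))
    (m<n⇒m<1+n m<k)
... | yes (i , aᵢ₀) =
  dependent-unshear w i β (steinitz m (tail s) (shear w i β) (tail ∘ a′) sa′≡shear m<k)
  where
  β : Fin k → F₂
  β t = a (punchIn i t) zero
  a′ : Fin k → Fin (suc m) → F₂
  a′ t u = a (punchIn i t) u xor (β t ∧ a i u)
  a′-head : ∀ t → a′ t zero ≡ false
  a′-head t = trans (cong (λ b → β t xor (β t ∧ b)) aᵢ₀)
                    (trans (cong (β t xor_) (∧-identityʳ (β t))) (xor-same (β t)))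
  sa′≡shear : ∀ t j → lincomb (tail (a′ t)) (tail s) j ≡ shear w i β t j
  sa′≡shear t j = begin
    lincomb (tail (a′ t)) (tail s) j
      ≡⟨ sym (lincomb-tail (a′ t) s (a′-head t) j) ⟩
    lincomb (a′ t) s j
      ≡⟨ lincomb-xor (a (punchIn i t)) (λ u → β t ∧ a i u) s j ⟩
    lincomb (a (punchIn i t)) s j xor lincomb (λ u → β t ∧ a i u) s j
      ≡⟨ cong (lincomb (a (punchIn i t)) s j xor_) (lincomb-scale (β t) (a i) s j) ⟩
    lincomb (a (punchIn i t)) s j xor (β t ∧ lincomb (a i) s j)
      ≡⟨ cong₂ (λ x y → x xor (β t ∧ y)) (sa≡w (punchIn i t) j) (sa≡w i j) ⟩
    shear w i β t j ∎
    where open ≡-Reasoning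

LinIndep-spanned⇒≤ : ∀ {s : Fin m → Vector F₂ n} {w : Fin k → Vector F₂ n} →
                     LinIndep w → (∀ i → w i ∈Span s) → k ≤ m
LinIndep-spanned⇒≤ {m} {k = k} {s = s} {w} independent w⊆s with k ≤? m
... | yes k≤m = k≤m
... | no  k≰m = contradiction independent
  (dependent⇒¬LinIndep (steinitz m s w (proj₁ ∘ w⊆s) (proj₂ ∘ w⊆s) (≰⇒> k≰m)))

record SpanningIndependentSubfamily (w : Fin m → Vector F₂ n) : Set where
  field
    size        : ℕ
    index       : Fin size → Fin m
    independent : LinIndep (w ∘ index)
    spanning    : ∀ i → w i ∈Span (w ∘ index)

spanningIndependentSubfamily : (w : Fin m → Vector F₂ n) → SpanningIndependentSubfamily w
spanningIndependentSubfamily {zero} w = record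
  { size = 0 ; index = λ () ; independent = λ _ _ () ; spanning = λ () }
spanningIndependentSubfamily {suc m} w with spanningIndependentSubfamily (tail w)
... | record { size = r ; index = f ; independent = ind ; spanning = sp }
    with w zero ∈Span? (tail w ∘ f)
...   | yes w₀∈ = record
  { size = r ; index = suc ∘ f ; independent = ind
  ; spanning = λ where zero → w₀∈ ; (suc i) → sp i }
...   | no w₀∉ = record
  { size = suc r ; index = zero ∷ (suc ∘ f) ; independent = LinIndep-∷ ind w₀∉
  ; spanning = λ where
      zero    → (true ∷ λ _ → false) , λ j →
                  trans (cong (w zero j xor_) (sum-replicate-zero r)) (xor-identityʳ (w zero j))
      (suc i) → let (c , eq) = sp i in (false ∷ c) , eq }

column : Mat n → Fin n → Vector F₂ n
column A c j = A j c

HasRank⇒spanning : ∀ {A : Mat n} {r} (hasRank : HasRank A r) →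
                   ∀ c → column A c ∈Span cols A (proj₁ (proj₁ hasRank))
HasRank⇒spanning {A = A} ((f , independent) , maximal) c with column A c ∈Span? cols A f
... | yes c∈ = c∈
... | no  c∉ = contradiction (LinIndep-∷ independent c∉) (maximal (c ∷ f))

HasRank-unique : ∀ {A : Mat n} {a b} → HasRank A a → HasRank A b → a ≡ b
HasRank-unique {A = A} a-rank@((fᵃ , a-independent) , _) b-rank@((fᵇ , b-independent) , _) = ≤-antisym
  (LinIndep-spanned⇒≤ a-independent (HasRank⇒spanning {A = A} b-rank ∘ fᵃ))
  (LinIndep-spanned⇒≤ b-independent (HasRank⇒spanning {A = A} a-rank ∘ fᵇ))

HasRank-cong : ∀ {A B : Mat n} {r} → A ≈ B → HasRank A r → HasRank B r
HasRank-cong {A = A} {B} A≈B ((f , independent) , maximal) =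
    (f , LinIndep-cong {u = cols A f} (λ i j → A≈B j (f i)) independent)
  , λ g → maximal g ∘ LinIndep-cong {u = cols B g} (λ i j → sym (A≈B j (g i)))

rankOf : (A : Mat n) → ∃ (HasRank A)
rankOf A = size , (index , independent) , maximal
  where
  open SpanningIndependentSubfamily (spanningIndependentSubfamily (column A))
  maximal : (f : Fin (suc size) → _) → ¬ LinIndep (cols A f)
  maximal f independentᶠ = n≮n size (LinIndep-spanned⇒≤ independentᶠ (spanning ∘ f))

abstract
  rank : Mat n → ℕ
  rank A = proj₁ (rankOf A)

  rank-HasRank : (A : Mat n) → HasRank A (rank A)
  rank-HasRank A = proj₂ (rankOf A)

rank-cong : ∀ {A B : Mat n} → A ≈ B → rank A ≡ rank B
rank-cong {A = A} {B} A≈B = HasRank-unique {A = B} (HasRank-cong A≈B (rank-HasRank A)) (rank-HasRank B)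

HasRank-𝟎 : HasRank (𝟎 {n}) 0
HasRank-𝟎 = ((λ ()) , λ _ _ ()) , λ f independent →
  contradiction (independent (λ _ → true) (λ _ → refl) zero) λ ()

rank-𝟎 : rank (𝟎 {n}) ≡ 0
rank-𝟎 {n} = HasRank-unique {A = 𝟎 {n}} (rank-HasRank 𝟎) HasRank-𝟎

rank-subadditive : (A B : Mat n) → rank A ≤ rank B + rank (A ⊖ B)
rank-subadditive A B = LinIndep-spanned⇒≤ {w = cols A _} (proj₂ (proj₁ (rank-HasRank A))) λ i →
  let (c , eq) = ∈Span-++ (HasRank⇒spanning {A = B} (rank-HasRank B) _)
                          (HasRank⇒spanning {A = A ⊖ B} (rank-HasRank (A ⊖ B)) _)
  in c , λ j → trans (eq j) (xor-recombine (B j _) (A j _))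

≼⇔rank-additive : ∀ {A B : Mat n} → B ≼ A ⇔ rank A ≡ rank B + rank (A ⊖ B)
≼⇔rank-additive {A = A} {B} = mk⇔
  (λ B≼A → B≼A _ _ _ (rank-HasRank A) (rank-HasRank B) (rank-HasRank (A ⊖ B)))
  (λ additive a b d a-rank b-rank d-rank → begin
    a                       ≡⟨ HasRank-unique {A = A} a-rank (rank-HasRank A) ⟩
    rank A                  ≡⟨ additive ⟩
    rank B + rank (A ⊖ B)   ≡⟨ cong₂ _+_ (HasRank-unique {A = B} (rank-HasRank B) b-rank)
                                         (HasRank-unique {A = A ⊖ B} (rank-HasRank (A ⊖ B)) d-rank) ⟩
    b + d                   ∎)
  where open ≡-Reasoning

𝟎≼ : (A : Mat n) → 𝟎 ≼ A
𝟎≼ A = Equivalence.from (≼⇔rank-additive {A = A} {𝟎})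
  (trans (sym (rank-cong λ i j → xor-identityʳ (A i j))) (cong (_+ rank (A ⊖ 𝟎)) (sym rank-𝟎)))

≼-respˡ-≈ : ∀ {A B B′ : Mat n} → B ≈ B′ → B ≼ A → B′ ≼ A
≼-respˡ-≈ {A = A} {B} {B′} B≈B′ B≼A = Equivalence.from (≼⇔rank-additive {A = A} {B′})
  (trans (Equivalence.to (≼⇔rank-additive {A = A} {B}) B≼A)
         (cong₂ _+_ (rank-cong B≈B′) (rank-cong λ i j → cong (A i j xor_) (B≈B′ i j))))

+-translate : ∀ {a a′ m d d′ e e′ : ℕ} → a ≡ m + d → a′ ≡ m + d′ → e ≡ e′ →
              (a′ ≡ a + e) ⇔ (d′ ≡ d + e′)
+-translate {m = m} {d} {d′} {e} refl refl refl = mk⇔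
  (λ eq → +-cancelˡ-≡ m d′ (d + e) (trans eq (+-assoc m d e)))
  (λ eq → trans (cong (m +_) eq) (sym (+-assoc m d e)))

≼-translate : ∀ {M A A′ : Mat n} → M ≼ A → M ≼ A′ → (A ≼ A′) ⇔ ((A ⊖ M) ≼ (A′ ⊖ M))
≼-translate {M = M} {A} {A′} M≼A M≼A′ =
  ⇔.trans (≼⇔rank-additive {A = A′} {A})
    (⇔.trans (+-translate (Equivalence.to (≼⇔rank-additive {A = A} {M}) M≼A)
                          (Equivalence.to (≼⇔rank-additive {A = A′} {M}) M≼A′)
                          (rank-cong λ i j → sym (xor-cancel-common (A′ i j) (A i j) (M i j))))
             (⇔.sym (≼⇔rank-additive {A = A′ ⊖ M} {A ⊖ M})))

≤-sandwich : ∀ {n m b c x : ℕ} → n ≡ m + (b + c) → x ≤ m + b → n ≤ x + c → x ≡ m + b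
≤-sandwich {m = m} {b} {c} {x} refl x≤m+b n≤x+c =
  ≤-antisym x≤m+b (+-cancelʳ-≤ c (m + b) x (subst (_≤ x + c) (sym (+-assoc m b c)) n≤x+c))

-- Both subadditivity bounds, rank (B ⊕ M) ≤ rank M + rank B and rank N ≤ rank (B ⊕ M) + rank C
-- with C = (N ⊖ M) ⊖ B, are tight because rank N = rank M + rank B + rank C.
≼-extend : ∀ {M N B : Mat n} → M ≼ N → B ≼ (N ⊖ M) → M ≼ (B ⊕ M)
≼-extend {M = M} {N} {B} M≼N B≼N⊖M = Equivalence.from (≼⇔rank-additive {A = B ⊕ M} {M})
  (trans rank-B⊕M (cong (rank M +_) (sym (rank-cong λ i j → xor-cancelʳ (B i j) (M i j)))))
  where
  rank-B⊕M : rank (B ⊕ M) ≡ rank M + rank B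
  rank-B⊕M = ≤-sandwich {m = rank M} {rank B}
    (trans (Equivalence.to (≼⇔rank-additive {A = N} {M}) M≼N)
           (cong (rank M +_) (Equivalence.to (≼⇔rank-additive {A = N ⊖ M} {B}) B≼N⊖M)))
    (subst (λ r → rank (B ⊕ M) ≤ rank M + r) (rank-cong λ i j → xor-cancelʳ (B i j) (M i j))
           (rank-subadditive (B ⊕ M) M))
    (subst (λ r → rank N ≤ rank (B ⊕ M) + r) (rank-cong λ i j → xor-rotate (N i j) (B i j) (M i j))
           (rank-subadditive N (B ⊕ M)))

HasRank-⊖ : ∀ {M A : Mat n} {m r} → M ≼ A → HasRank M m → HasRank A r → HasRank (A ⊖ M) (r ∸ m)
HasRank-⊖ {M = M} {A} {m} {r} M≼A m-rank r-rank =
  subst (HasRank (A ⊖ M)) rank≡r∸m (rank-HasRank (A ⊖ M))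
  where
  rank≡r∸m : rank (A ⊖ M) ≡ r ∸ m
  rank≡r∸m = trans (sym (m+n∸m≡n m _))
                   (cong (_∸ m) (sym (M≼A r m _ r-rank m-rank (rank-HasRank (A ⊖ M)))))

proposition2p21 : (n : ℕ) (M₁ M₂ : Mat n) (m₁ m₂ : ℕ) →
    M₁ ≼ M₂ → HasRank M₁ m₁ → HasRank M₂ m₂ → m₁ ≤ m₂ →
    ((A : Mat n) → InInterval M₁ M₂ A → InInterval 𝟎 (M₂ ⊖ M₁) (ψ M₁ A)) ×
    ((B : Mat n) → InInterval 𝟎 (M₂ ⊖ M₁) B → InInterval M₁ M₂ (φ M₁ B)) ×
    ((A : Mat n) → InInterval M₁ M₂ A → φ M₁ (ψ M₁ A) ≈ A) ×
    ((B : Mat n) → InInterval 𝟎 (M₂ ⊖ M₁) B → ψ M₁ (φ M₁ B) ≈ B) ×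
    ((A A′ : Mat n) → InInterval M₁ M₂ A → InInterval M₁ M₂ A′ →
      (A ≼ A′) ⇔ (ψ M₁ A ≼ ψ M₁ A′)) ×
    ((A : Mat n) (r : ℕ) → InInterval M₁ M₂ A → HasRank A r → HasRank (ψ M₁ A) (r ∸ m₁))
proposition2p21 n M₁ M₂ _ _ M₁≼M₂ M₁-rank _ _ =
    (λ A (M₁≼A , A≼M₂) →
       𝟎≼ (ψ M₁ A) , Equivalence.to (≼-translate {M = M₁} {A} {M₂} M₁≼A M₁≼M₂) A≼M₂)
  , (λ B (_ , B≼M₂⊖M₁) →
       let M₁≼φB = ≼-extend {M = M₁} {M₂} {B} M₁≼M₂ B≼M₂⊖M₁
       in M₁≼φB , Equivalence.from (≼-translate {M = M₁} {φ M₁ B} {M₂} M₁≼φB M₁≼M₂)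
                    (≼-respˡ-≈ {A = M₂ ⊖ M₁} (λ i j → sym (ψ∘φ≈id B i j)) B≼M₂⊖M₁))
  , (λ A _ i j → xor-cancelʳ (A i j) (M₁ i j))
  , (λ B _ → ψ∘φ≈id B)
  , (λ A A′ (M₁≼A , _) (M₁≼A′ , _) → ≼-translate {M = M₁} {A} {A′} M₁≼A M₁≼A′)
  , (λ A r (M₁≼A , _) → HasRank-⊖ {M = M₁} {A} M₁≼A M₁-rank)
  where
  ψ∘φ≈id : (B : Mat n) → ψ M₁ (φ M₁ B) ≈ B
  ψ∘φ≈id B i j = xor-cancelʳ (B i j) (M₁ i j)
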